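{- Let $p \geq 5$ be a prime and $n\ge 1$ such that $H_{p^n}$ is infinite and uncollapsed. If $k$ is an integer such that $(bc)^k \in \langle a,b\rangle$ or $(bac)^k \in \langle a,b\rangle$ in $H_{p^n}$, then $k$ is a multiple of $p^n$.
   Context: For a positive integer $m$, $H_m = \langle a,b,c \mid a^2,b^2,c^2,(ab)^3,(ac)^2,(bc)^m,(bac)^m\rangle$. We write $H_m = H_j$ if the two presentations define the same quotient of the free group on $a,b,c$ (the normal closures of the relator sets coincide). $H_m$ is uncollapsed if $H_m \neq H_j$ for all integers $1\le j<m$. -}

module Defs where

open import Data.Nat using (ℕ; zero; suc; _≤_; _<_)
open import Data.Integer using (ℤ; +_; -[1+_])
open import Data.Bool using (Bool; true; false; not)
open import Data.Product using (_×_; _,_; Σ; ∃)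
open import Data.List using (List; []; _∷_; _++_; reverse; map)
open import Data.List.Relation.Unary.All using (All)
open import Data.List.Relation.Unary.Any using (Any)
open import Relation.Nullary using (¬_)
open import Function.Bundles using (_⇔_)

data Gen : Set where
  a b c : Gen

-- A letter is a generator with an exponent sign: (g , true) = g, (g , false) = g⁻¹
Letter : Set
Letter = Gen × Bool

Word : Set
Word = List Letter

gen : Gen → Word
gen g = (g , true) ∷ []

invL : Letter → Letter
invL (g , s) = (g , not s)

inv : Word → Word
inv w = reverse (map invL w)

_^ʷ_ : Word → ℕ → Word
w ^ʷ zero = []
w ^ʷ suc n = w ++ (w ^ʷ n)

powℤ : Word → ℤ → Word
powℤ w (+ n) = w ^ʷ n
powℤ w -[1+ n ] = inv w ^ʷ suc n

ab ac bc bac : Word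
ab = gen a ++ gen b
ac = gen a ++ gen c
bc = gen b ++ gen c
bac = gen b ++ gen a ++ gen c

data Relator (m : ℕ) : Word → Set where
  r-a²    : Relator m (gen a ^ʷ 2)
  r-b²    : Relator m (gen b ^ʷ 2)
  r-c²    : Relator m (gen c ^ʷ 2)
  r-ab³   : Relator m (ab ^ʷ 3)
  r-ac²   : Relator m (ac ^ʷ 2)
  r-bcᵐ   : Relator m (bc ^ʷ m)
  r-bacᵐ  : Relator m (bac ^ʷ m)

-- Equality of words in H_m = F(a,b,c) / ⟪relators⟫ : the smallest
-- congruence on words containing free cancellation and the relators.
data _≈[_]_ : Word → ℕ → Word → Set where
  ≈-refl   : ∀ {m w} → w ≈[ m ] w
  ≈-sym    : ∀ {m u v} → u ≈[ m ] v → v ≈[ m ] u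
  ≈-trans  : ∀ {m u v w} → u ≈[ m ] v → v ≈[ m ] w → u ≈[ m ] w
  ≈-cong   : ∀ {m u v} (x y : Word) → u ≈[ m ] v → (x ++ u ++ y) ≈[ m ] (x ++ v ++ y)
  ≈-free   : ∀ {m} (l : Letter) → (l ∷ invL l ∷ []) ≈[ m ] []
  ≈-rel    : ∀ {m r} → Relator m r → r ≈[ m ] []

InNormalClosure : ℕ → Word → Set
InNormalClosure m w = w ≈[ m ] []

SameQuotient : ℕ → ℕ → Set
SameQuotient m j = ∀ (w : Word) → InNormalClosure m w ⇔ InNormalClosure j w

Uncollapsed : ℕ → Set
Uncollapsed m = ∀ (j : ℕ) → 1 ≤ j → j < m → ¬ SameQuotient m j

FiniteH : ℕ → Set
FiniteH m = Σ (List Word) λ L → ∀ (w : Word) → Any (λ v → w ≈[ m ] v) L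

InfiniteH : ℕ → Set
InfiniteH m = ¬ FiniteH m

isAB : Letter → Set
isAB (a , _) = Data.Unit.⊤ where import Data.Unit
isAB (b , _) = Data.Unit.⊤ where import Data.Unit
isAB (c , _) = Data.Empty.⊥ where import Data.Empty

InAB : ℕ → Word → Set
InAB m w = Σ Word λ v → All isAB v × (w ≈[ m ] v)

-- Lemma 6.11: if p ≥ 5 is prime, m = pⁿ, H_m is uncollapsed and (bc)ᵏ or
-- (bac)ᵏ lies in ⟨a,b⟩, then m divides k.
--
-- The subgroup ⟨a,b⟩ is a quotient of ⟨a,b | a², b², (ab)³⟩ ≅ S₃, so
-- every element of it has order dividing 6; hence (bc)^(6|k|) = 1 (resp.
-- (bac)^(6|k|) = 1).  Together with (bc)^m = 1 and Bézout this gives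
-- (bc)^g = 1 for g = gcd(m, 6|k|).  The substitution c ↦ ac induces an
-- endomorphism of every H_m sending bc to bac and bac to bc, so
-- (bac)^g = 1 as well.  Since g ∣ m, the relator sets of H_m and
-- H_g then have the same normal closure, and uncollapsedness forces g = m.
-- Thus m ∣ 6|k|, and as m = pⁿ is coprime to 2 and 3, m ∣ k.
module Submission where

open import Defs
open import Data.Nat using (ℕ; _≤_; _^_)
open import Data.Nat.Primality using (Prime)
open import Data.Integer using (ℤ; +_)
open import Data.Integer.Divisibility using (_∣_)
open import Data.Sum using (_⊎_)

open import Data.Nat using (NonZero; zero; suc; _+_; _*_; _<_; z≤n; s≤s; ≢-nonZero⁻¹)
open import Data.Nat.Primality using (prime⇒nonZero)
import Data.Nat.Properties as ℕₚ
import Data.Nat.Divisibility as ℕ∣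
open import Data.Nat.GCD using (gcd; module Bézout; gcd[m,n]∣m; gcd[m,n]∣n; gcd-GCD)
open import Data.Nat.Coprimality using (Coprime; coprime-divisor; prime⇒coprime)
open import Data.Integer using (-[1+_])
import Data.Integer as ℤ
open import Data.Bool using (true; false)
open import Data.Product using (_×_; _,_; Σ)
open import Data.Sum using (inj₁; inj₂)
open import Data.List using ([]; _∷_; _++_)
open import Data.List.Properties using (++-assoc; ++-identityʳ)
open import Data.List.Relation.Unary.All using (All; []; _∷_)
open import Data.Empty using (⊥-elim)
open import Relation.Binary.PropositionalEquality
open import Function.Bundles using (mk⇔)

infixr 5 _∙_

_∙_ : ∀ {m u v w} → u ≈[ m ] v → v ≈[ m ] w → u ≈[ m ] w
_∙_ = ≈-trans

≡⇒≈ : ∀ {m u v} → u ≡ v → u ≈[ m ] v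
≡⇒≈ refl = ≈-refl

≈-cong-≡ : ∀ {m} x y {u v L R} → L ≡ x ++ u ++ y → x ++ v ++ y ≡ R →
           u ≈[ m ] v → L ≈[ m ] R
≈-cong-≡ x y refl refl e = ≈-cong x y e

++-≈ˡ : ∀ {m u v} y → u ≈[ m ] v → (u ++ y) ≈[ m ] (v ++ y)
++-≈ˡ y e = ≈-cong [] y e

++-≈ʳ : ∀ {m u v} x → u ≈[ m ] v → (x ++ u) ≈[ m ] (x ++ v)
++-≈ʳ {u = u} {v} x e =
  ≈-cong-≡ x [] (cong (x ++_) (sym (++-identityʳ u))) (cong (x ++_) (++-identityʳ v)) e

^ʷ-+ : ∀ x i j → x ^ʷ (i + j) ≡ x ^ʷ i ++ x ^ʷ j
^ʷ-+ x zero    j = refl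
^ʷ-+ x (suc i) j = trans (cong (x ++_) (^ʷ-+ x i j)) (sym (++-assoc x (x ^ʷ i) (x ^ʷ j)))

^ʷ-* : ∀ x i j → (x ^ʷ i) ^ʷ j ≡ x ^ʷ (j * i)
^ʷ-* x i zero    = refl
^ʷ-* x i (suc j) = trans (cong (x ^ʷ i ++_) (^ʷ-* x i j)) (sym (^ʷ-+ x i (j * i)))

-- x^(n+1) = xⁿx, the form of the recursion needed to cancel against inverses.
^ʷ-suc-right : ∀ x n → x ^ʷ suc n ≡ x ^ʷ n ++ x
^ʷ-suc-right x n =
  trans (cong (x ^ʷ_) (ℕₚ.+-comm 1 n)) (trans (^ʷ-+ x n 1) (cong (x ^ʷ n ++_) (++-identityʳ x)))

^ʷ-≈ : ∀ {m x y} n → x ≈[ m ] y → (x ^ʷ n) ≈[ m ] (y ^ʷ n)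
^ʷ-≈ zero    e = ≈-refl
^ʷ-≈ (suc n) e = ++-≈ˡ _ e ∙ ++-≈ʳ _ (^ʷ-≈ n e)

^ʷ-trivial : ∀ {m x} n → x ≈[ m ] [] → (x ^ʷ n) ≈[ m ] []
^ʷ-trivial zero    e = ≈-refl
^ʷ-trivial (suc n) e = ++-≈ˡ _ e ∙ ^ʷ-trivial n e

multiple-trivial : ∀ {m} x t s → (x ^ʷ t) ≈[ m ] [] → (x ^ʷ (s * t)) ≈[ m ] []
multiple-trivial x t s e = ≡⇒≈ (sym (^ʷ-* x t s)) ∙ ^ʷ-trivial s e

^ʷ-cancel : ∀ {m} x y n → (x ++ y) ≈[ m ] [] → (x ^ʷ n ++ y ^ʷ n) ≈[ m ] []
^ʷ-cancel x y zero    e = ≈-refl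
^ʷ-cancel x y (suc n) e = ≈-cong-≡ x y regroup refl (^ʷ-cancel x y n e) ∙ e
  where
  regroup : (x ++ x ^ʷ n) ++ y ^ʷ suc n ≡ x ++ (x ^ʷ n ++ y ^ʷ n) ++ y
  regroup = trans (cong ((x ++ x ^ʷ n) ++_) (^ʷ-suc-right y n))
            (trans (++-assoc x (x ^ʷ n) (y ^ʷ n ++ y))
                   (cong (x ++_) (sym (++-assoc (x ^ʷ n) (y ^ʷ n) y))))

inverse-power-trivial : ∀ {m} x y n → (x ++ y) ≈[ m ] [] → (y ^ʷ n) ≈[ m ] [] →
                        (x ^ʷ n) ≈[ m ] []
inverse-power-trivial x y n xy=1 yⁿ=1 =
  ≡⇒≈ (sym (++-identityʳ _)) ∙ ++-≈ʳ (x ^ʷ n) (≈-sym yⁿ=1) ∙ ^ʷ-cancel x y n xy=1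

absorb : ∀ {m x} d t → (x ^ʷ t) ≈[ m ] [] → (x ^ʷ d) ≈[ m ] (x ^ʷ (d + t))
absorb {x = x} d t h =
  ≡⇒≈ (sym (++-identityʳ _)) ∙ ++-≈ʳ (x ^ʷ d) (≈-sym h) ∙ ≡⇒≈ (sym (^ʷ-+ x d t))

bézout-trivial : ∀ {m x d} A B → Bézout.Identity d A B →
                 (x ^ʷ A) ≈[ m ] [] → (x ^ʷ B) ≈[ m ] [] → (x ^ʷ d) ≈[ m ] []
bézout-trivial {x = x} {d} A B (Bézout.+- s t eq) hA hB =
  absorb d (t * B) (multiple-trivial x B t hB) ∙ ≡⇒≈ (cong (x ^ʷ_) eq) ∙ multiple-trivial x A s hA
bézout-trivial {x = x} {d} A B (Bézout.-+ s t eq) hA hB =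
  absorb d (s * A) (multiple-trivial x A s hA) ∙ ≡⇒≈ (cong (x ^ʷ_) eq) ∙ multiple-trivial x B t hB

gcd-trivial : ∀ {m x} A B → (x ^ʷ A) ≈[ m ] [] → (x ^ʷ B) ≈[ m ] [] →
              (x ^ʷ gcd A B) ≈[ m ] []
gcd-trivial A B = bézout-trivial A B (Bézout.identity (gcd-GCD A B))

A B C A⁻ B⁻ C⁻ : Letter
A  = (a , true)
B  = (b , true)
C  = (c , true)
A⁻ = (a , false)
B⁻ = (b , false)
C⁻ = (c , false)

module _ {m : ℕ} where
  aa : (A ∷ A ∷ []) ≈[ m ] []
  aa = ≈-rel r-a²

  bb : (B ∷ B ∷ []) ≈[ m ] []
  bb = ≈-rel r-b²

  a⁻¹=a : (A⁻ ∷ []) ≈[ m ] (A ∷ [])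
  a⁻¹=a = ≈-sym (≈-cong (A⁻ ∷ []) [] aa) ∙ ≈-cong [] (A ∷ []) (≈-free A⁻)

  b⁻¹=b : (B⁻ ∷ []) ≈[ m ] (B ∷ [])
  b⁻¹=b = ≈-sym (≈-cong (B⁻ ∷ []) [] bb) ∙ ≈-cong [] (B ∷ []) (≈-free B⁻)

  abba : (A ∷ B ∷ B ∷ A ∷ []) ≈[ m ] []
  abba = ≈-cong (A ∷ []) (A ∷ []) bb ∙ aa

  abab=ba : (A ∷ B ∷ A ∷ B ∷ []) ≈[ m ] (B ∷ A ∷ [])
  abab=ba = ≈-sym (≈-cong (A ∷ B ∷ A ∷ B ∷ []) [] abba) ∙ ≈-cong [] (B ∷ A ∷ []) (≈-rel r-ab³)

  bab=aba : (B ∷ A ∷ B ∷ []) ≈[ m ] (A ∷ B ∷ A ∷ [])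
  bab=aba = ≈-sym (≈-cong [] (B ∷ A ∷ B ∷ []) aa) ∙ ≈-cong (A ∷ []) [] abab=ba

-- The six normal forms of ⟨a,b | a², b², (ab)³⟩ ≅ S₃.
data S₃ : Word → Set where
  s-e   : S₃ []
  s-a   : S₃ (A ∷ [])
  s-b   : S₃ (B ∷ [])
  s-ab  : S₃ (A ∷ B ∷ [])
  s-ba  : S₃ (B ∷ A ∷ [])
  s-aba : S₃ (A ∷ B ∷ A ∷ [])

NormalForm : ℕ → Word → Set
NormalForm m v = Σ Word λ w → S₃ w × (v ≈[ m ] w)

a·_ : ∀ {m w} → S₃ w → NormalForm m (A ∷ w)
a· s-e   = _ , s-a   , ≈-refl
a· s-a   = _ , s-e   , aa
a· s-b   = _ , s-ab  , ≈-refl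
a· s-ab  = _ , s-b   , ≈-cong [] (B ∷ []) aa
a· s-ba  = _ , s-aba , ≈-refl
a· s-aba = _ , s-ba  , ≈-cong [] (B ∷ A ∷ []) aa

b·_ : ∀ {m w} → S₃ w → NormalForm m (B ∷ w)
b· s-e   = _ , s-b   , ≈-refl
b· s-a   = _ , s-ba  , ≈-refl
b· s-b   = _ , s-e   , bb
b· s-ab  = _ , s-aba , bab=aba
b· s-ba  = _ , s-a   , ≈-cong [] (A ∷ []) bb
b· s-aba = _ , s-ab  , ≈-cong [] (A ∷ []) bab=aba ∙ ≈-cong (A ∷ B ∷ []) [] aa

letter· : ∀ {m w} l → isAB l → S₃ w → NormalForm m (l ∷ w)
letter· (a , true)  _ s = a· s
letter· {w = w} (a , false) _ s with a· s
... | w′ , s′ , e = w′ , s′ , ≈-cong [] w a⁻¹=a ∙ e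
letter· (b , true)  _ s = b· s
letter· {w = w} (b , false) _ s with b· s
... | w′ , s′ , e = w′ , s′ , ≈-cong [] w b⁻¹=b ∙ e
letter· (c , _) () s

normalise : ∀ {m v} → All isAB v → NormalForm m v
normalise [] = _ , s-e , ≈-refl
normalise {v = l ∷ v} (l-ab ∷ v-ab) with normalise v-ab
... | w , s , e with letter· l l-ab s
... | w′ , s′ , e′ = w′ , s′ , ++-≈ʳ (l ∷ []) e ∙ e′

-- Each normal form has order 1, 2 or 3, so its sixth power is trivial.
normal-form-order∣6 : ∀ {m w} → S₃ w → (w ^ʷ 6) ≈[ m ] []
normal-form-order∣6 s-e   = ≈-refl
normal-form-order∣6 s-a   = multiple-trivial (A ∷ []) 2 3 aa
normal-form-order∣6 s-b   = multiple-trivial (B ∷ []) 2 3 bb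
normal-form-order∣6 s-ab  = multiple-trivial (A ∷ B ∷ []) 3 2 (≈-rel r-ab³)
normal-form-order∣6 s-ba  = multiple-trivial (B ∷ A ∷ []) 3 2
  (≈-cong (B ∷ []) [] (≈-cong [] (A ∷ []) abab=ba ∙ ≈-cong (B ∷ []) [] aa) ∙ bb)
normal-form-order∣6 s-aba = multiple-trivial (A ∷ B ∷ A ∷ []) 2 3
  (≈-cong (A ∷ B ∷ []) (B ∷ A ∷ []) aa ∙ abba)

-- If some integer power xᵏ lies in ⟨a,b⟩, then x^(6|k|) = 1.
-- (x ++ inv x = 1 is needed to pass from negative to positive powers.)
power-in-AB⇒order∣6k : ∀ {m} x → (x ++ inv x) ≈[ m ] [] → (k : ℤ) →
                       InAB m (powℤ x k) → (x ^ʷ (6 * ℤ.∣ k ∣)) ≈[ m ] []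
power-in-AB⇒order∣6k {m} x _ (+ n) (v , v-ab , xⁿ=v) with normalise {m} v-ab
... | w , s , v=w = ≡⇒≈ (sym (^ʷ-* x n 6)) ∙ ^ʷ-≈ 6 (xⁿ=v ∙ v=w) ∙ normal-form-order∣6 s
power-in-AB⇒order∣6k {m} x x⁻¹ -[1+ n ] (v , v-ab , x⁻ⁿ=v) with normalise {m} v-ab
... | w , s , v=w = inverse-power-trivial x (inv x) (6 * suc n) x⁻¹
  (≡⇒≈ (sym (^ʷ-* (inv x) (suc n) 6)) ∙ ^ʷ-≈ 6 (x⁻ⁿ=v ∙ v=w) ∙ normal-form-order∣6 s)

bc·bc⁻¹ : ∀ {m} → (bc ++ inv bc) ≈[ m ] []
bc·bc⁻¹ = ≈-cong (B ∷ []) (B⁻ ∷ []) (≈-free C) ∙ ≈-free B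

bac·bac⁻¹ : ∀ {m} → (bac ++ inv bac) ≈[ m ] []
bac·bac⁻¹ =
  ≈-cong (B ∷ A ∷ []) (A⁻ ∷ B⁻ ∷ []) (≈-free C) ∙ ≈-cong (B ∷ []) (B⁻ ∷ []) (≈-free A) ∙ ≈-free B

φ-letter : Letter → Word
φ-letter (a , s)     = (a , s) ∷ []
φ-letter (b , s)     = (b , s) ∷ []
φ-letter (c , true)  = A ∷ C ∷ []
φ-letter (c , false) = C⁻ ∷ A⁻ ∷ []

φ : Word → Word
φ []      = []
φ (l ∷ w) = φ-letter l ++ φ w

φ-++ : ∀ u v → φ (u ++ v) ≡ φ u ++ φ v
φ-++ []      v = refl
φ-++ (l ∷ u) v = trans (cong (φ-letter l ++_) (φ-++ u v)) (sym (++-assoc (φ-letter l) (φ u) (φ v)))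

φ-^ʷ : ∀ x n → φ (x ^ʷ n) ≡ φ x ^ʷ n
φ-^ʷ x zero    = refl
φ-^ʷ x (suc n) = trans (φ-++ x (x ^ʷ n)) (cong (φ x ++_) (φ-^ʷ x n))

-- φ(bac) = baac = bc.
φbac=bc : ∀ {m} → φ bac ≈[ m ] bc
φbac=bc = ≈-cong (B ∷ []) (C ∷ []) aa

-- φ maps every relator of H_m to a relator (c² ↦ (ac)², (bc)ᵐ ↔ (bac)ᵐ),
-- hence is well defined on H_m.
φ-resp : ∀ {m u v} → u ≈[ m ] v → φ u ≈[ m ] φ v
φ-resp ≈-refl        = ≈-refl
φ-resp (≈-sym e)     = ≈-sym (φ-resp e)
φ-resp (≈-trans e f) = φ-resp e ∙ φ-resp f
φ-resp (≈-cong {u = u} {v} x y e) =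
  ≈-cong-≡ (φ x) (φ y) (trans (φ-++ x (u ++ y)) (cong (φ x ++_) (φ-++ u y)))
           (sym (trans (φ-++ x (v ++ y)) (cong (φ x ++_) (φ-++ v y)))) (φ-resp e)
φ-resp (≈-free (a , s))     = ≈-free (a , s)
φ-resp (≈-free (b , s))     = ≈-free (b , s)
φ-resp (≈-free (c , true))  = ≈-cong (A ∷ []) (A⁻ ∷ []) (≈-free C) ∙ ≈-free A
φ-resp (≈-free (c , false)) = ≈-cong (C⁻ ∷ []) (C ∷ []) (≈-free A⁻) ∙ ≈-free C⁻
φ-resp (≈-rel r-a²)  = ≈-rel r-a²
φ-resp (≈-rel r-b²)  = ≈-rel r-b²
φ-resp (≈-rel r-c²)  = ≈-rel r-ac²
φ-resp (≈-rel r-ab³) = ≈-rel r-ab³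
φ-resp (≈-rel r-ac²) =
  ≈-cong [] (C ∷ A ∷ A ∷ C ∷ []) aa ∙ ≈-cong (C ∷ []) (C ∷ []) aa ∙ ≈-rel r-c²
φ-resp {m} (≈-rel r-bcᵐ)  = ≡⇒≈ (φ-^ʷ bc m) ∙ ≈-rel r-bacᵐ
φ-resp {m} (≈-rel r-bacᵐ) = ≡⇒≈ (φ-^ʷ bac m) ∙ ^ʷ-≈ m φbac=bc ∙ ≈-rel r-bcᵐ

bcᵍ⇒bacᵍ : ∀ {m} g → (bc ^ʷ g) ≈[ m ] [] → (bac ^ʷ g) ≈[ m ] []
bcᵍ⇒bacᵍ g e = ≡⇒≈ (sym (φ-^ʷ bc g)) ∙ φ-resp e

bacᵍ⇒bcᵍ : ∀ {m} g → (bac ^ʷ g) ≈[ m ] [] → (bc ^ʷ g) ≈[ m ] []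
bacᵍ⇒bcᵍ g e = ^ʷ-≈ g (≈-sym φbac=bc) ∙ ≡⇒≈ (sym (φ-^ʷ bac g)) ∙ φ-resp e

relators-trivial⇒⊆ : ∀ {j m u v} → (∀ {r} → Relator j r → r ≈[ m ] []) →
                     u ≈[ j ] v → u ≈[ m ] v
relators-trivial⇒⊆ h ≈-refl         = ≈-refl
relators-trivial⇒⊆ h (≈-sym e)      = ≈-sym (relators-trivial⇒⊆ h e)
relators-trivial⇒⊆ h (≈-trans e f)  = relators-trivial⇒⊆ h e ∙ relators-trivial⇒⊆ h f
relators-trivial⇒⊆ h (≈-cong x y e) = ≈-cong x y (relators-trivial⇒⊆ h e)
relators-trivial⇒⊆ h (≈-free l)     = ≈-free l
relators-trivial⇒⊆ h (≈-rel r)      = h r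

divisor-relators⇒same : ∀ m g → g ℕ∣.∣ m →
  (bc ^ʷ g) ≈[ m ] [] → (bac ^ʷ g) ≈[ m ] [] → SameQuotient m g
divisor-relators⇒same m g (ℕ∣.divides q m≡qg) bcᵍ=1 bacᵍ=1 w =
  mk⇔ (relators-trivial⇒⊆ m-in-g) (relators-trivial⇒⊆ g-in-m)
  where
  mth-power : ∀ x → (x ^ʷ g) ≈[ g ] [] → (x ^ʷ m) ≈[ g ] []
  mth-power x xᵍ=1 = ≡⇒≈ (cong (x ^ʷ_) m≡qg) ∙ multiple-trivial x g q xᵍ=1

  m-in-g : ∀ {r} → Relator m r → r ≈[ g ] []
  m-in-g r-a²   = ≈-rel r-a²
  m-in-g r-b²   = ≈-rel r-b²
  m-in-g r-c²   = ≈-rel r-c²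
  m-in-g r-ab³  = ≈-rel r-ab³
  m-in-g r-ac²  = ≈-rel r-ac²
  m-in-g r-bcᵐ  = mth-power bc (≈-rel r-bcᵐ)
  m-in-g r-bacᵐ = mth-power bac (≈-rel r-bacᵐ)

  g-in-m : ∀ {r} → Relator g r → r ≈[ m ] []
  g-in-m r-a²   = ≈-rel r-a²
  g-in-m r-b²   = ≈-rel r-b²
  g-in-m r-c²   = ≈-rel r-c²
  g-in-m r-ab³  = ≈-rel r-ab³
  g-in-m r-ac²  = ≈-rel r-ac²
  g-in-m r-bcᵐ  = bcᵍ=1
  g-in-m r-bacᵐ = bacᵍ=1

uncollapsed⇒divisor≡ : ∀ m g .{{_ : NonZero m}} → Uncollapsed m → g ℕ∣.∣ m →
                       SameQuotient m g → g ≡ m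
uncollapsed⇒divisor≡ m g uncollapsed g∣m same with ℕₚ.m≤n⇒m<n∨m≡n (ℕ∣.∣⇒≤ g∣m)
... | inj₁ g<m = ⊥-elim (uncollapsed g 1≤g g<m same)
  where
  1≤g : 1 ≤ g
  1≤g = ℕₚ.n≢0⇒n>0 λ { refl → ≢-nonZero⁻¹ m (ℕ∣.0∣⇒≡0 g∣m) }
... | inj₂ g≡m = g≡m

coprime-*ˡ : ∀ {x y q} → Coprime x q → Coprime y q → Coprime (x * y) q
coprime-*ˡ {x} {y} {q} x⊥q y⊥q {d} (d∣xy , d∣q) = y⊥q (coprime-divisor d⊥x d∣xy , d∣q)
  where
  d⊥x : Coprime d x
  d⊥x (e∣d , e∣x) = x⊥q (e∣x , ℕ∣.∣-trans e∣d d∣q)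

coprime-^ˡ : ∀ {p q} → Coprime p q → ∀ n → Coprime (p ^ n) q
coprime-^ˡ p⊥q zero    (d∣1 , _) = ℕ∣.∣1⇒≡1 d∣1
coprime-^ˡ p⊥q (suc n) = coprime-*ˡ p⊥q (coprime-^ˡ p⊥q n)

-- pⁿ is coprime to 2 and 3, so it can be cancelled from a divisibility pⁿ ∣ 6N.
prime≥5-power-cancel-6 : ∀ {p} n N → Prime p → 5 ≤ p → p ^ n ℕ∣.∣ 6 * N → p ^ n ℕ∣.∣ N
prime≥5-power-cancel-6 {p} n N p-prime 5≤p m∣6N =
  coprime-divisor (coprime-^ˡ (p⊥ 3 (s≤s (s≤s (s≤s (s≤s z≤n))))) n)
    (coprime-divisor (coprime-^ˡ (p⊥ 2 (s≤s (s≤s (s≤s z≤n)))) n)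
      (subst (p ^ n ℕ∣.∣_) (ℕₚ.*-assoc 2 3 N) m∣6N))
  where
  p⊥ : ∀ q .{{_ : NonZero q}} → q < 5 → Coprime p q
  p⊥ q q<5 = prime⇒coprime p-prime (ℕₚ.<-≤-trans q<5 5≤p)

lemma6p11 : (p n : ℕ) → Prime p → 5 ≤ p → 1 ≤ n →
            InfiniteH (p ^ n) → Uncollapsed (p ^ n) →
            (k : ℤ) → InAB (p ^ n) (powℤ bc k) ⊎ InAB (p ^ n) (powℤ bac k) →
            (+ (p ^ n)) ∣ k
lemma6p11 p n p-prime 5≤p _ _ uncollapsed k in-AB =
  prime≥5-power-cancel-6 n N p-prime 5≤p (subst (ℕ∣._∣ 6 * N) g≡m (gcd[m,n]∣n m (6 * N)))
  where
  m N g : ℕ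
  m = p ^ n
  N = ℤ.∣ k ∣
  g = gcd m (6 * N)
  instance
    m≢0 : NonZero m
    m≢0 = ℕₚ.m^n≢0 p n {{prime⇒nonZero p-prime}}

  -- (bc)ᵍ = (bac)ᵍ = 1: one of them by Bézout on m and 6|k|, the other via φ.
  g-kills : InAB m (powℤ bc k) ⊎ InAB m (powℤ bac k) →
            (bc ^ʷ g) ≈[ m ] [] × (bac ^ʷ g) ≈[ m ] []
  g-kills (inj₁ bcᵏ∈AB) = bcᵍ=1 , bcᵍ⇒bacᵍ g bcᵍ=1
    where
    bcᵍ=1 : (bc ^ʷ g) ≈[ m ] []
    bcᵍ=1 = gcd-trivial m (6 * N) (≈-rel r-bcᵐ) (power-in-AB⇒order∣6k bc bc·bc⁻¹ k bcᵏ∈AB)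
  g-kills (inj₂ bacᵏ∈AB) = bacᵍ⇒bcᵍ g bacᵍ=1 , bacᵍ=1
    where
    bacᵍ=1 : (bac ^ʷ g) ≈[ m ] []
    bacᵍ=1 = gcd-trivial m (6 * N) (≈-rel r-bacᵐ) (power-in-AB⇒order∣6k bac bac·bac⁻¹ k bacᵏ∈AB)

  g≡m : g ≡ m
  g≡m with g-kills in-AB
  ... | bcᵍ=1 , bacᵍ=1 = uncollapsed⇒divisor≡ m g uncollapsed (gcd[m,n]∣m m (6 * N))
                           (divisor-relators⇒same m g (gcd[m,n]∣m m (6 * N)) bcᵍ=1 bacᵍ=1)
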